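{- For any $n\ge1$ and any $w\in\mathbf{SL}_n(021)$, we have $\mathsf{R}_{\mathsf{lar}}(w)=n$; that is, the last entry of $w$ is its largest entry.
   Context: $\mathbf{N}_n$ is the set of sequences $w=w_1\cdots w_n$ of nonnegative integers. For such $w$: $\mathsf{lar}(w)=\max_i w_i$, $\mathsf{sma}(w)=\min_i w_i$, $\mathsf{R}_{\mathsf{lar}}(w)=\max\{i:w_i=\mathsf{lar}(w)\}$, $\mathsf{R}_{\mathsf{sma}}(w)=\max\{i:w_i=\mathsf{sma}(w)\}$. $\mathbf{SL}_n=\{w\in\mathbf{N}_n:\mathsf{R}_{\mathsf{lar}}(w)\ge\mathsf{R}_{\mathsf{sma}}(w)\}$. $\mathbf{SL}_n(021)$ is the set of $w\in\mathbf{SL}_n$ having no indices $i<j<k$ with $w_i<w_k<w_j$. -}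

module Defs where

open import Data.Nat using (ℕ; zero; suc; _⊔_; _⊓_; _≤_; _<_; _≟_)
open import Data.Fin using (Fin; toℕ)
open import Data.Vec using (Vec; []; _∷_; lookup)
open import Data.Product using (∃; _×_)
open import Relation.Nullary using (¬_; yes; no)
open import Relation.Binary.PropositionalEquality using (_≡_)

-- A word w ∈ N_n (n ≥ 1) is a vector of n naturals; position i : Fin n
-- corresponds to the 1-based index toℕ i + 1.

lar : ∀ {m} → Vec ℕ (suc m) → ℕ
lar (x ∷ []) = x
lar (x ∷ y ∷ ys) = x ⊔ lar (y ∷ ys)

sma : ∀ {m} → Vec ℕ (suc m) → ℕ
sma (x ∷ []) = x
sma (x ∷ y ∷ ys) = x ⊓ sma (y ∷ ys)

-- lastIndexOf v a = max{ i : v_i = a } (1-based), or 0 if there is none.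
lastIndexOf : ∀ {n} → Vec ℕ n → ℕ → ℕ
lastIndexOf [] a = 0
lastIndexOf {suc n} (x ∷ xs) a with lastIndexOf xs a
... | suc k = suc (suc k)
... | zero with x ≟ a
...   | yes _ = 1
...   | no _ = 0

Rlar : ∀ {m} → Vec ℕ (suc m) → ℕ
Rlar w = lastIndexOf w (lar w)

Rsma : ∀ {m} → Vec ℕ (suc m) → ℕ
Rsma w = lastIndexOf w (sma w)

InSL : ∀ {m} → Vec ℕ (suc m) → Set
InSL w = Rsma w ≤ Rlar w

Contains021 : ∀ {n} → Vec ℕ n → Set
Contains021 {n} w = ∃ λ (i : Fin n) → ∃ λ (j : Fin n) → ∃ λ (k : Fin n) →
  (toℕ i < toℕ j) × (toℕ j < toℕ k) ×
  (lookup w i < lookup w k) × (lookup w k < lookup w j)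

InSL021 : ∀ {m} → Vec ℕ (suc m) → Set
InSL021 w = InSL w × ¬ Contains021 w

{-# OPTIONS --safe #-}
module Submission where

-- Let j be the last position of the maximum and i that of the minimum, so
-- i ≤ j by the SL condition.  If j were not the final position ℓ, then
-- w_ℓ < lar w (ℓ lies after the last maximum) and sma w < w_ℓ (ℓ lies after
-- the last minimum).  For i < j the positions i < j < ℓ form a 021 pattern;
-- for i = j the minimum equals the maximum, contradicting sma w < w_ℓ < lar w.

open import Defs
open import Data.Nat using (ℕ; suc; zero; _≤_; _<_; z≤n; s≤s; _≟_)
open import Data.Nat.Properties
open import Data.Fin using (Fin; toℕ; fromℕ) renaming (zero to fz; suc to fs)
open import Data.Fin.Properties using (toℕ-fromℕ; toℕ-injective; toℕ≤pred[n])
open import Data.Vec using (Vec; []; _∷_; lookup)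
open import Data.Product using (Σ; _×_; _,_)
open import Data.Sum using (inj₁; inj₂)
open import Data.Empty using (⊥-elim)
open import Function using (case_of_)
open import Relation.Nullary using (¬_; yes; no)
open import Relation.Binary.PropositionalEquality

lastIndexOf-sound : ∀ {n} (w : Vec ℕ n) {a k} → lastIndexOf w a ≡ suc k →
                    Σ (Fin n) λ j → toℕ j ≡ k × lookup w j ≡ a
lastIndexOf-sound (x ∷ xs) {a} eq with lastIndexOf xs a in e
... | suc k with lastIndexOf-sound xs e
...   | j , j≡k , wⱼ = fs j , trans (cong suc j≡k) (suc-injective eq) , wⱼ
lastIndexOf-sound (x ∷ xs) {a} eq | zero with x ≟ a
... | yes x≡a = fz , suc-injective eq , x≡a
lastIndexOf-sound (x ∷ xs) () | zero | no _

lookup≡⇒<lastIndexOf : ∀ {n} (w : Vec ℕ n) {a} (i : Fin n) → lookup w i ≡ a →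
                       toℕ i < lastIndexOf w a
lookup≡⇒<lastIndexOf (x ∷ xs) {a} fz x≡a with lastIndexOf xs a
... | suc _ = s≤s z≤n
... | zero with x ≟ a
...   | yes _ = s≤s z≤n
...   | no x≢a = ⊥-elim (x≢a x≡a)
lookup≡⇒<lastIndexOf (x ∷ xs) {a} (fs i) wᵢ≡a
  with lastIndexOf xs a | lookup≡⇒<lastIndexOf xs i wᵢ≡a
... | suc _ | i<k = s≤s i<k

lastIndexOf-attained : ∀ {n} (w : Vec ℕ n) {a} (i : Fin n) → lookup w i ≡ a →
                       Σ (Fin n) λ j → lastIndexOf w a ≡ suc (toℕ j) × lookup w j ≡ a
lastIndexOf-attained w {a} i wᵢ≡a with lastIndexOf w a in e | lookup≡⇒<lastIndexOf w i wᵢ≡a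
... | suc k | _ with lastIndexOf-sound w e
...   | j , j≡k , wⱼ = j , cong suc (sym j≡k) , wⱼ

lastIndexOf≤⇒lookup≢ : ∀ {n} (w : Vec ℕ n) {a} (i : Fin n) → lastIndexOf w a ≤ toℕ i →
                       lookup w i ≢ a
lastIndexOf≤⇒lookup≢ w i ≤i wᵢ≡a = <-irrefl refl (<-≤-trans (lookup≡⇒<lastIndexOf w i wᵢ≡a) ≤i)

lookup≤lar : ∀ {m} (w : Vec ℕ (suc m)) (i : Fin (suc m)) → lookup w i ≤ lar w
lookup≤lar (x ∷ []) fz = ≤-refl
lookup≤lar (x ∷ y ∷ ys) fz = m≤m⊔n x _
lookup≤lar (x ∷ y ∷ ys) (fs i) = ≤-trans (lookup≤lar (y ∷ ys) i) (m≤n⊔m x _)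

lar-attained : ∀ {m} (w : Vec ℕ (suc m)) → Σ (Fin (suc m)) λ i → lookup w i ≡ lar w
lar-attained (x ∷ []) = fz , refl
lar-attained (x ∷ y ∷ ys) with ⊔-sel x (lar (y ∷ ys))
... | inj₁ x⊔≡x = fz , sym x⊔≡x
... | inj₂ x⊔≡lar with lar-attained (y ∷ ys)
...   | i , wᵢ = fs i , trans wᵢ (sym x⊔≡lar)

sma≤lookup : ∀ {m} (w : Vec ℕ (suc m)) (i : Fin (suc m)) → sma w ≤ lookup w i
sma≤lookup (x ∷ []) fz = ≤-refl
sma≤lookup (x ∷ y ∷ ys) fz = m⊓n≤m x _
sma≤lookup (x ∷ y ∷ ys) (fs i) = ≤-trans (m⊓n≤n x _) (sma≤lookup (y ∷ ys) i)

sma-attained : ∀ {m} (w : Vec ℕ (suc m)) → Σ (Fin (suc m)) λ i → lookup w i ≡ sma w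
sma-attained (x ∷ []) = fz , refl
sma-attained (x ∷ y ∷ ys) with ⊓-sel x (sma (y ∷ ys))
... | inj₁ x⊓≡x = fz , sym x⊓≡x
... | inj₂ x⊓≡sma with sma-attained (y ∷ ys)
...   | i , wᵢ = fs i , trans wᵢ (sym x⊓≡sma)

lastMax-at-end : ∀ {m} (w : Vec ℕ (suc m)) (i j : Fin (suc m)) →
                 lastIndexOf w (sma w) ≡ suc (toℕ i) → lookup w i ≡ sma w →
                 lastIndexOf w (lar w) ≡ suc (toℕ j) → lookup w j ≡ lar w →
                 toℕ i ≤ toℕ j → ¬ Contains021 w → toℕ j ≡ m
lastMax-at-end {m} w i j Rsma≡ wᵢ Rlar≡ wⱼ i≤j avoids with toℕ j ≟ m
... | yes j≡m = j≡m
... | no j≢m = ⊥-elim (case m≤n⇒m<n∨m≡n i≤j of λ where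
        (inj₁ i<j) → avoids (i , j , end , i<j , j<end ,
                             subst (_< lookup w end) (sym wᵢ) sma<wₑ ,
                             subst (lookup w end <_) (sym wⱼ) wₑ<lar)
        (inj₂ i≡j) → <-asym sma<wₑ (subst (lookup w end <_) (lar≡sma i≡j) wₑ<lar))
  where
  end : Fin (suc m)
  end = fromℕ m

  j<end : toℕ j < toℕ end
  j<end = subst (toℕ j <_) (sym (toℕ-fromℕ m)) (≤∧≢⇒< (toℕ≤pred[n] j) j≢m)

  wₑ<lar : lookup w end < lar w
  wₑ<lar = ≤∧≢⇒< (lookup≤lar w end)
                 (lastIndexOf≤⇒lookup≢ w end (subst (_≤ toℕ end) (sym Rlar≡) j<end))

  sma<wₑ : sma w < lookup w end
  sma<wₑ = ≤∧≢⇒< (sma≤lookup w end)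
                 (≢-sym (lastIndexOf≤⇒lookup≢ w end
                          (subst (_≤ toℕ end) (sym Rsma≡) (≤-<-trans i≤j j<end))))

  lar≡sma : toℕ i ≡ toℕ j → lar w ≡ sma w
  lar≡sma i≡j = begin
    lar w          ≡⟨ sym wⱼ ⟩
    lookup w j     ≡⟨ cong (lookup w) (toℕ-injective (sym i≡j)) ⟩
    lookup w i     ≡⟨ wᵢ ⟩
    sma w          ∎
    where open ≡-Reasoning

mainTheorem7 : (m : ℕ) (w : Vec ℕ (suc m)) → InSL021 w → Rlar w ≡ suc m
mainTheorem7 m w (inSL , avoids)
  with lar-attained w | sma-attained w
... | k , wₖ | l , wₗ
  with lastIndexOf-attained w k wₖ | lastIndexOf-attained w l wₗ
... | j , Rlar≡ , wⱼ | i , Rsma≡ , wᵢ =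
  trans Rlar≡ (cong suc (lastMax-at-end w i j Rsma≡ wᵢ Rlar≡ wⱼ i≤j avoids))
  where
  i≤j : toℕ i ≤ toℕ j
  i≤j = ≤-pred (subst₂ _≤_ Rsma≡ Rlar≡ inSL)
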